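{- Let $P(z)=p_1z^{e_1}+\dots+p_mz^{e_m}$ be a polynomial with complex coefficients and nonnegative integer exponents $e_1<\dots<e_m$, and let $b_1,\dots,b_t$ be positive integers ($t\ge1$). For $0\le u\le t$ let $E_u^{(t)}=E_u^{(t)}(b_1,\dots,b_t)$. Then \[ \sum_{u=0}^{t}E_u^{(t)}z^uP^{(u)}(z)=\sum_{i=1}^{m}p_iz^{e_i}D(b_1,\dots,b_t,e_i). \]
   Context: For integers $e,h\ge0$ let $(e)_h$ denote the falling factorial: $(e)_0=1$ and $(e)_h=e(e-1)\cdots(e-h+1)$ for $h\ge1$. For a positive integer $t$ and integer $e\ge0$, let $\Delta_t^-(e)$ be the column vector $((e)_0,(e)_1,\dots,(e)_t)^{T}$ of length $t+1$, and for $0\le u\le t$ let $\Delta_{t,u}^-(e)$ be the column vector of length $t$ obtained from $\Delta_t^-(e)$ by deleting the entry $(e)_u$. Define $E_u^{(t)}(b_1,\dots,b_t)=(-1)^{t+u}\det\big(\Delta_{t,u}^-(b_1),\dots,\Delta_{t,u}^-(b_t)\big)$ (a $t\times t$ determinant) and $D(b_1,\dots,b_t,e)=\det\big(\Delta_t^-(b_1),\dots,\Delta_t^-(b_t),\Delta_t^-(e)\big)$ (a $(t+1)\times(t+1)$ determinant). -}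

module Defs where

open import Level using (Level)
open import Algebra.Bundles using (CommutativeRing)
open import Data.Nat using (ℕ; zero; suc; _∸_)
import Data.Nat as N
open import Data.Fin using (Fin; zero; suc; toℕ; punchIn; fromℕ; inject₁)
open import Data.Product using (_×_; _,_; proj₁; proj₂)

ff : ℕ → ℕ → ℕ
ff e zero    = 1
ff e (suc h) = ff e h N.* (e ∸ h)

snocF : ∀ {a} {A : Set a} (t : ℕ) → (Fin t → A) → A → Fin (suc t) → A
snocF zero    b e zero    = e
snocF (suc t) b e zero    = b zero
snocF (suc t) b e (suc c) = snocF t (λ i → b (suc i)) e c

module WithRing {c ℓ : Level} (R : CommutativeRing c ℓ) where
  open CommutativeRing R using (Carrier; _+_; _*_; -_; 0#; 1#)

  ι : ℕ → Carrier
  ι zero    = 0#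
  ι (suc n) = 1# + ι n

  pow : Carrier → ℕ → Carrier
  pow x zero    = 1#
  pow x (suc n) = x * pow x n

  sgn : ℕ → Carrier
  sgn zero    = 1#
  sgn (suc n) = - sgn n

  sumF : (n : ℕ) → (Fin n → Carrier) → Carrier
  sumF zero    f = 0#
  sumF (suc n) f = f zero + sumF n (λ i → f (suc i))

  det : (n : ℕ) → (Fin n → Fin n → Carrier) → Carrier
  det zero    M = 1#
  det (suc n) M =
    sumF (suc n) (λ j → sgn (toℕ j) * (M zero j * det n (λ r c → M (suc r) (punchIn j c))))

  -- E_u^{(t)}(b_1,…,b_t) = (-1)^{t+u} det(Δ⁻_{t,u}(b_1),…,Δ⁻_{t,u}(b_t));
  -- row r of Δ⁻_{t,u}(e) is (e)_{h} where h runs over {0,…,t} \ {u}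
  E : (t : ℕ) → Fin (suc t) → (Fin t → ℕ) → Carrier
  E t u b = sgn (t N.+ toℕ u) * det t (λ r c → ι (ff (b c) (toℕ (punchIn u r))))

  -- D(b_1,…,b_t,e) = det(Δ⁻_t(b_1),…,Δ⁻_t(b_t),Δ⁻_t(e))
  D : (t : ℕ) → (Fin t → ℕ) → ℕ → Carrier
  D t b e = det (suc t) (λ r c → ι (ff (snocF t b e c) (toℕ r)))

  Poly : ℕ → Set c
  Poly m = (Fin m → Carrier) × (Fin m → ℕ)

  evalP : ∀ {m} → Poly m → Carrier → Carrier
  evalP {m} (p , e) z = sumF m (λ i → p i * pow z (e i))

  deriv : ∀ {m} → Poly m → Poly m
  deriv (p , e) = (λ i → ι (e i) * p i) , (λ i → e i ∸ 1)

  derivN : ∀ {m} → ℕ → Poly m → Poly m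
  derivN zero    P = P
  derivN (suc u) P = deriv (derivN u P)

-- Expanding D(b, e) along its last column Δ⁻_t(e) gives D(b, e) = Σ_u E_u (e)_u.
-- On the other side z^u P^{(u)}(z) = Σ_i p_i (e_i)_u z^{e_i}, since (e)_u vanishes
-- precisely when u > e.  Substituting and exchanging the two finite sums gives the identity.
module Submission where

open import Defs
open import Level using (Level)
open import Algebra.Bundles using (CommutativeRing)
open import Data.Nat using (ℕ; _≤_; _<_)
open import Data.Fin using (Fin; toℕ; zero; suc; punchIn; fromℕ; inject₁)
open import Data.Product using (_,_; proj₁; proj₂)
import Data.Nat as ℕ
import Data.Nat.Properties as ℕ
import Data.Fin.Properties as Fin
open import Data.Sum using (inj₁; inj₂)
open import Relation.Binary.PropositionalEquality as ≡ using (_≡_)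
open import Relation.Nullary using (yes; no)

punchIn-fromℕ : ∀ n (i : Fin n) → punchIn (fromℕ n) i ≡ inject₁ i
punchIn-fromℕ (ℕ.suc n) zero    = ≡.refl
punchIn-fromℕ (ℕ.suc n) (suc i) = ≡.cong suc (punchIn-fromℕ n i)

punchIn-inject₁-fromℕ : ∀ n (i : Fin (ℕ.suc n)) → punchIn (inject₁ i) (fromℕ n) ≡ fromℕ (ℕ.suc n)
punchIn-inject₁-fromℕ n         zero    = ≡.refl
punchIn-inject₁-fromℕ (ℕ.suc n) (suc i) = ≡.cong suc (punchIn-inject₁-fromℕ n i)

punchIn-inject₁-inject₁ : ∀ {n} (i : Fin (ℕ.suc n)) (j : Fin n) →
  punchIn (inject₁ i) (inject₁ j) ≡ inject₁ (punchIn i j)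
punchIn-inject₁-inject₁ zero    j       = ≡.refl
punchIn-inject₁-inject₁ (suc i) zero    = ≡.refl
punchIn-inject₁-inject₁ (suc i) (suc j) = ≡.cong suc (punchIn-inject₁-inject₁ i j)

snocF-fromℕ : ∀ {a} {A : Set a} t (b : Fin t → A) e → snocF t b e (fromℕ t) ≡ e
snocF-fromℕ ℕ.zero    b e = ≡.refl
snocF-fromℕ (ℕ.suc t) b e = snocF-fromℕ t (λ i → b (suc i)) e

snocF-inject₁ : ∀ {a} {A : Set a} t (b : Fin t → A) e i → snocF t b e (inject₁ i) ≡ b i
snocF-inject₁ (ℕ.suc t) b e zero    = ≡.refl
snocF-inject₁ (ℕ.suc t) b e (suc i) = snocF-inject₁ t (λ j → b (suc j)) e i

ff-≡0 : ∀ {e u} → e < u → ff e u ≡ 0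
ff-≡0 {e} {ℕ.suc u} (ℕ.s≤s e≤u) with ℕ.m≤n⇒m<n∨m≡n e≤u
... | inj₁ e<u    rewrite ff-≡0 e<u = ≡.refl
... | inj₂ ≡.refl rewrite ℕ.n∸n≡0 e = ℕ.*-zeroʳ (ff e e)

module WithRingProperties {c ℓ : Level} (R : CommutativeRing c ℓ) where
  open CommutativeRing R hiding (zero)
  open WithRing R
  open import Algebra.Properties.Ring ring using (-‿involutive)
  open import Algebra.Properties.Semiring.Sum semiring using (sum; ∑-comm; sum-init-last; sum-cong-≗)
  open import Algebra.Properties.Semiring.Mult semiring using (_×_; ×1-homo-*)
  open import Algebra.Properties.Semiring.Exp semiring using (_^_; ^-homo-*)
  open import Algebra.Properties.CommutativeSemigroup *-commutativeSemigroup using (x∙yz≈y∙xz; x∙yz≈xz∙y; x∙yz≈yx∙z; xy∙z≈y∙zx)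
  open import Relation.Binary.Reasoning.Setoid setoid

  sumF≡sum : ∀ n (f : Fin n → Carrier) → sumF n f ≡ sum f
  sumF≡sum ℕ.zero    f = ≡.refl
  sumF≡sum (ℕ.suc n) f = ≡.cong (f zero +_) (sumF≡sum n (λ i → f (suc i)))

  sumF-cong : ∀ n {f g : Fin n → Carrier} → (∀ i → f i ≈ g i) → sumF n f ≈ sumF n g
  sumF-cong ℕ.zero    f≈g = refl
  sumF-cong (ℕ.suc n) f≈g = +-cong (f≈g zero) (sumF-cong n (λ i → f≈g (suc i)))

  sumF-*ˡ : ∀ n x (f : Fin n → Carrier) → x * sumF n f ≈ sumF n (λ i → x * f i)
  sumF-*ˡ ℕ.zero    x f = zeroʳ x
  sumF-*ˡ (ℕ.suc n) x f = trans (distribˡ x _ _) (+-congˡ (sumF-*ˡ n x (λ i → f (suc i))))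

  sumF-comm : ∀ n m (f : Fin n → Fin m → Carrier) →
    sumF n (λ i → sumF m (f i)) ≈ sumF m (λ j → sumF n (λ i → f i j))
  sumF-comm n m f = begin
    sumF n (λ i → sumF m (f i))          ≡⟨ sumF≡sum n _ ⟩
    sum (λ i → sumF m (f i))             ≡⟨ sum-cong-≗ (λ i → sumF≡sum m (f i)) ⟩
    sum (λ i → sum (f i))                ≈⟨ ∑-comm f ⟩
    sum (λ j → sum (λ i → f i j))        ≡⟨ sum-cong-≗ (λ j → ≡.sym (sumF≡sum n (λ i → f i j))) ⟩
    sum (λ j → sumF n (λ i → f i j))     ≡⟨ ≡.sym (sumF≡sum m _) ⟩
    sumF m (λ j → sumF n (λ i → f i j))  ∎

  sumF-init-last : ∀ n (f : Fin (ℕ.suc n) → Carrier) →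
    sumF (ℕ.suc n) f ≈ sumF n (λ i → f (inject₁ i)) + f (fromℕ n)
  sumF-init-last n f = begin
    sumF (ℕ.suc n) f                        ≡⟨ sumF≡sum (ℕ.suc n) f ⟩
    sum f                                   ≈⟨ sum-init-last f ⟩
    sum (λ i → f (inject₁ i)) + f (fromℕ n) ≡⟨ ≡.cong (_+ f (fromℕ n)) (≡.sym (sumF≡sum n _)) ⟩
    sumF n (λ i → f (inject₁ i)) + f (fromℕ n) ∎

  ι≡×1# : ∀ n → ι n ≡ n × 1#
  ι≡×1# ℕ.zero    = ≡.refl
  ι≡×1# (ℕ.suc n) = ≡.cong (1# +_) (ι≡×1# n)

  ι-* : ∀ m n → ι (m ℕ.* n) ≈ ι m * ι n
  ι-* m n rewrite ι≡×1# (m ℕ.* n) | ι≡×1# m | ι≡×1# n = ×1-homo-* m n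

  pow≡^ : ∀ x n → pow x n ≡ x ^ n
  pow≡^ x ℕ.zero    = ≡.refl
  pow≡^ x (ℕ.suc n) = ≡.cong (x *_) (pow≡^ x n)

  pow-+ : ∀ x m n → pow x (m ℕ.+ n) ≈ pow x m * pow x n
  pow-+ x m n rewrite pow≡^ x (m ℕ.+ n) | pow≡^ x m | pow≡^ x n = ^-homo-* x m n

  sumF-*ˡ₂ : ∀ n x y (f : Fin n → Carrier) → x * (y * sumF n f) ≈ sumF n (λ i → x * (y * f i))
  sumF-*ˡ₂ n x y f = trans (*-congˡ (sumF-*ˡ n y f)) (sumF-*ˡ n x (λ i → y * f i))

  x*[y*[z*w]]≈z*[x*[y*w]] : ∀ x y z w → x * (y * (z * w)) ≈ z * (x * (y * w))
  x*[y*[z*w]]≈z*[x*[y*w]] x y z w = trans (*-congˡ (x∙yz≈y∙xz y z w)) (x∙yz≈y∙xz x z (y * w))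

  Matrix : ℕ → Set c
  Matrix n = Fin n → Fin n → Carrier

  firstRowTerm : ∀ n → Matrix (ℕ.suc n) → Fin (ℕ.suc n) → Carrier
  firstRowTerm n M j = sgn (toℕ j) * (M zero j * det n (λ r c → M (suc r) (punchIn j c)))

  det-cong : ∀ n {M N : Matrix n} → (∀ r c → M r c ≈ N r c) → det n M ≈ det n N
  det-cong ℕ.zero    M≈N = refl
  det-cong (ℕ.suc n) {M} {N} M≈N = sumF-cong (ℕ.suc n) firstRowTerm-cong
    where
    firstRowTerm-cong : ∀ j → firstRowTerm n M j ≈ firstRowTerm n N j
    firstRowTerm-cong j =
      *-congˡ (*-cong (M≈N zero j) (det-cong n (λ r c → M≈N (suc r) (punchIn j c))))

  lastColumnMinor : ∀ {n} → Fin (ℕ.suc n) → Matrix (ℕ.suc n) → Matrix n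
  lastColumnMinor u M r c = M (punchIn u r) (inject₁ c)

  lastColumnTerm : ∀ n → Matrix (ℕ.suc n) → Fin (ℕ.suc n) → Carrier
  lastColumnTerm n M u = sgn (n ℕ.+ toℕ u) * (M u (fromℕ n) * det n (lastColumnMinor u M))

  -- Expand along the first row, expand each first-row minor along its last column by
  -- induction, and regroup the double sum by rows: the inner sums are then first-row
  -- expansions of the last-column minors, with signs differing by (-1)^2.
  det-expand-lastColumn : ∀ n (M : Matrix (ℕ.suc n)) →
    det (ℕ.suc n) M ≈ sumF (ℕ.suc n) (lastColumnTerm n M)
  det-expand-lastColumn ℕ.zero    M = refl
  det-expand-lastColumn (ℕ.suc k) M = begin
    det (ℕ.suc n) M
      ≈⟨ sumF-init-last n (firstRowTerm n M) ⟩
    sumF n (λ j → firstRowTerm n M (inject₁ j)) + firstRowTerm n M (fromℕ n)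
      ≈⟨ +-comm _ _ ⟩
    firstRowTerm n M (fromℕ n) + sumF n (λ j → firstRowTerm n M (inject₁ j))
      ≈⟨ +-cong cornerTerm (sumF-cong n expandMinor) ⟩
    lastColumnTerm n M zero + sumF n (λ j → sumF n (λ u → term j u))
      ≈⟨ +-congˡ (sumF-comm n n term) ⟩
    lastColumnTerm n M zero + sumF n (λ u → sumF n (λ j → term j u))
      ≈⟨ +-congˡ (sumF-cong n collect) ⟩
    sumF (ℕ.suc n) (lastColumnTerm n M) ∎
    where
    n : ℕ
    n = ℕ.suc k
    doubleMinor : Fin n → Fin n → Carrier
    doubleMinor j u = det k (λ r c → M (suc (punchIn u r)) (inject₁ (punchIn j c)))
    term : Fin n → Fin n → Carrier
    term j u = sgn (k ℕ.+ toℕ u) * (M (suc u) (fromℕ n) * (sgn (toℕ j) * (M zero (inject₁ j) * doubleMinor j u)))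

    cornerTerm : firstRowTerm n M (fromℕ n) ≈ lastColumnTerm n M zero
    cornerTerm = *-cong
      (reflexive (≡.cong sgn (≡.trans (Fin.toℕ-fromℕ n) (≡.sym (ℕ.+-identityʳ n)))))
      (*-congˡ (det-cong n (λ r c → reflexive (≡.cong (M (suc r)) (punchIn-fromℕ n c)))))

    expandMinor : ∀ j → firstRowTerm n M (inject₁ j) ≈ sumF n (term j)
    expandMinor j = begin
      sgn (toℕ (inject₁ j)) * (M zero (inject₁ j) * det n N)
        ≈⟨ *-cong (reflexive (≡.cong sgn (Fin.toℕ-inject₁ j))) (*-congˡ (det-expand-lastColumn k N)) ⟩
      sgn (toℕ j) * (M zero (inject₁ j) * sumF n (lastColumnTerm k N))
        ≈⟨ sumF-*ˡ₂ n _ _ (lastColumnTerm k N) ⟩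
      sumF n (λ u → sgn (toℕ j) * (M zero (inject₁ j) * lastColumnTerm k N u))
        ≈⟨ sumF-cong n rearrange ⟩
      sumF n (term j) ∎
      where
      N : Matrix n
      N r c = M (suc r) (punchIn (inject₁ j) c)
      rearrange : ∀ u → sgn (toℕ j) * (M zero (inject₁ j) * lastColumnTerm k N u) ≈ term j u
      rearrange u = begin
        sgn (toℕ j) * (M zero (inject₁ j) * (sgn (k ℕ.+ toℕ u) * (N u (fromℕ k) * det k (lastColumnMinor u N))))
          ≈⟨ x*[y*[z*w]]≈z*[x*[y*w]] _ _ _ _ ⟩
        sgn (k ℕ.+ toℕ u) * (sgn (toℕ j) * (M zero (inject₁ j) * (N u (fromℕ k) * det k (lastColumnMinor u N))))
          ≈⟨ *-congˡ (x*[y*[z*w]]≈z*[x*[y*w]] _ _ _ _) ⟩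
        sgn (k ℕ.+ toℕ u) * (N u (fromℕ k) * (sgn (toℕ j) * (M zero (inject₁ j) * det k (lastColumnMinor u N))))
          ≈⟨ *-congˡ (*-cong lastEntry (*-congˡ (*-congˡ minor))) ⟩
        term j u ∎
        where
        lastEntry : N u (fromℕ k) ≈ M (suc u) (fromℕ n)
        lastEntry = reflexive (≡.cong (M (suc u)) (punchIn-inject₁-fromℕ k j))
        minor : det k (lastColumnMinor u N) ≈ doubleMinor j u
        minor = det-cong k (λ r c → reflexive (≡.cong (M (suc (punchIn u r))) (punchIn-inject₁-inject₁ j c)))

    collect : ∀ u → sumF n (λ j → term j u) ≈ lastColumnTerm n M (suc u)
    collect u = begin
      sumF n (λ j → term j u)
        ≈⟨ sym (sumF-*ˡ₂ n _ _ (firstRowTerm k (lastColumnMinor (suc u) M))) ⟩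
      sgn (k ℕ.+ toℕ u) * (M (suc u) (fromℕ n) * det n (lastColumnMinor (suc u) M))
        ≈⟨ *-congʳ (sym (trans (reflexive (≡.cong sgn (ℕ.+-suc n (toℕ u)))) (-‿involutive _))) ⟩
      lastColumnTerm n M (suc u) ∎

  D-expand-lastColumn : ∀ t b e → D t b e ≈ sumF (ℕ.suc t) (λ u → E t u b * ι (ff e (toℕ u)))
  D-expand-lastColumn t b e = trans (det-expand-lastColumn t Δ) (sumF-cong (ℕ.suc t) cofactor)
    where
    Δ : Matrix (ℕ.suc t)
    Δ r c = ι (ff (snocF t b e c) (toℕ r))
    cofactor : ∀ u → lastColumnTerm t Δ u ≈ E t u b * ι (ff e (toℕ u))
    cofactor u = trans (*-congˡ (*-cong lastEntry minor)) (x∙yz≈xz∙y _ _ _)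
      where
      lastEntry : Δ u (fromℕ t) ≈ ι (ff e (toℕ u))
      lastEntry = reflexive (≡.cong (λ x → ι (ff x (toℕ u))) (snocF-fromℕ t b e))
      minor : det t (lastColumnMinor u Δ) ≈ det t (λ r c → ι (ff (b c) (toℕ (punchIn u r))))
      minor = det-cong t (λ r c → reflexive (≡.cong (λ x → ι (ff x (toℕ (punchIn u r)))) (snocF-inject₁ t b e c)))

  derivN-exponent : ∀ {m} u (P : Poly m) i → proj₂ (derivN u P) i ≡ proj₂ P i ℕ.∸ u
  derivN-exponent ℕ.zero    P i = ≡.refl
  derivN-exponent (ℕ.suc u) P i = ≡.trans (≡.cong (ℕ._∸ 1) (derivN-exponent u P i))
    (≡.trans (ℕ.∸-+-assoc (proj₂ P i) u 1) (≡.cong (proj₂ P i ℕ.∸_) (ℕ.+-comm u 1)))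

  derivN-coefficient : ∀ {m} u (P : Poly m) i → proj₁ (derivN u P) i ≈ ι (ff (proj₂ P i) u) * proj₁ P i
  derivN-coefficient ℕ.zero    P i = sym (trans (*-congʳ (+-identityʳ 1#)) (*-identityˡ _))
  derivN-coefficient (ℕ.suc u) P i = begin
    ι (proj₂ (derivN u P) i) * proj₁ (derivN u P) i
      ≈⟨ *-cong (reflexive (≡.cong ι (derivN-exponent u P i))) (derivN-coefficient u P i) ⟩
    ι (e ℕ.∸ u) * (ι (ff e u) * proj₁ P i)   ≈⟨ x∙yz≈yx∙z _ _ _ ⟩
    (ι (ff e u) * ι (e ℕ.∸ u)) * proj₁ P i   ≈⟨ *-congʳ (sym (ι-* (ff e u) (e ℕ.∸ u))) ⟩
    ι (ff e (ℕ.suc u)) * proj₁ P i           ∎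
    where e = proj₂ P i

  -- For u > e the truncated exponent e ∸ u is wrong, but then (e)_u = 0 kills the term.
  pow-*-derivN-monomial : ∀ x u e p →
    pow x u * ((ι (ff e u) * p) * pow x (e ℕ.∸ u)) ≈ p * (pow x e * ι (ff e u))
  pow-*-derivN-monomial x u e p with u ℕ.≤? e
  ... | yes u≤e = begin
    pow x u * ((ι (ff e u) * p) * pow x (e ℕ.∸ u))   ≈⟨ x∙yz≈y∙xz _ _ _ ⟩
    (ι (ff e u) * p) * (pow x u * pow x (e ℕ.∸ u))   ≈⟨ *-congˡ (sym (pow-+ x u (e ℕ.∸ u))) ⟩
    (ι (ff e u) * p) * pow x (u ℕ.+ (e ℕ.∸ u))       ≡⟨ ≡.cong (λ n → (ι (ff e u) * p) * pow x n) (ℕ.m+[n∸m]≡n u≤e) ⟩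
    (ι (ff e u) * p) * pow x e                       ≈⟨ xy∙z≈y∙zx _ _ _ ⟩
    p * (pow x e * ι (ff e u))                       ∎
  ... | no u≰e rewrite ff-≡0 (ℕ.≰⇒> u≰e) = begin
    pow x u * ((0# * p) * pow x (e ℕ.∸ u))   ≈⟨ *-congˡ (trans (*-congʳ (zeroˡ p)) (zeroˡ _)) ⟩
    pow x u * 0#                             ≈⟨ zeroʳ _ ⟩
    0#                                       ≈⟨ sym (trans (*-congˡ (zeroʳ _)) (zeroʳ p)) ⟩
    p * (pow x e * 0#)                       ∎

  pow-*-evalP-derivN : ∀ {m} u (p : Fin m → Carrier) e x →
    pow x u * evalP (derivN u (p , e)) x ≈ sumF m (λ i → p i * (pow x (e i) * ι (ff (e i) u)))
  pow-*-evalP-derivN {m} u p e x = trans (sumF-*ˡ m (pow x u) _) (sumF-cong m monomial)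
    where
    P : Poly m
    P = derivN u (p , e)
    monomial : ∀ i → pow x u * (proj₁ P i * pow x (proj₂ P i)) ≈ p i * (pow x (e i) * ι (ff (e i) u))
    monomial i = trans
      (*-congˡ (*-cong (derivN-coefficient u (p , e) i) (reflexive (≡.cong (pow x) (derivN-exponent u (p , e) i)))))
      (pow-*-derivN-monomial x u (e i) (p i))

lemma5p4 : ∀ {c ℓ : Level} (R : CommutativeRing c ℓ) →
    let open CommutativeRing R
        open WithRing R
    in (m : ℕ) (p : Fin m → Carrier) (e : Fin m → ℕ) →
       (∀ i j → toℕ i < toℕ j → e i < e j) →
       (t : ℕ) → 1 ≤ t → (b : Fin t → ℕ) → (∀ k → 1 ≤ b k) →
       (z : Carrier) →
       sumF (ℕ.suc t) (λ u → E t u b * (pow z (toℕ u) * evalP (derivN (toℕ u) (p , e)) z))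
         ≈ sumF m (λ i → p i * (pow z (e i) * D t b (e i)))
lemma5p4 R m p e _ t _ b _ z = begin
  sumF (ℕ.suc t) (λ u → E t u b * (pow z (toℕ u) * evalP (derivN (toℕ u) (p , e)) z))
    ≈⟨ sumF-cong (ℕ.suc t) expandDerivative ⟩
  sumF (ℕ.suc t) (λ u → sumF m (λ i → E t u b * term i u))
    ≈⟨ sumF-comm (ℕ.suc t) m (λ u i → E t u b * term i u) ⟩
  sumF m (λ i → sumF (ℕ.suc t) (λ u → E t u b * term i u))
    ≈⟨ sumF-cong m collectD ⟩
  sumF m (λ i → p i * (pow z (e i) * D t b (e i))) ∎
  where
  open CommutativeRing R
  open WithRing R
  open WithRingProperties R
  open import Relation.Binary.Reasoning.Setoid setoid
  term : Fin m → Fin (ℕ.suc t) → Carrier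
  term i u = p i * (pow z (e i) * ι (ff (e i) (toℕ u)))
  expandDerivative : ∀ u →
    E t u b * (pow z (toℕ u) * evalP (derivN (toℕ u) (p , e)) z) ≈ sumF m (λ i → E t u b * term i u)
  expandDerivative u =
    trans (*-congˡ (pow-*-evalP-derivN (toℕ u) p e z)) (sumF-*ˡ m (E t u b) (λ i → term i u))
  collectD : ∀ i → sumF (ℕ.suc t) (λ u → E t u b * term i u) ≈ p i * (pow z (e i) * D t b (e i))
  collectD i = begin
    sumF (ℕ.suc t) (λ u → E t u b * term i u)
      ≈⟨ sumF-cong (ℕ.suc t) (λ u → sym (x*[y*[z*w]]≈z*[x*[y*w]] (p i) (pow z (e i)) (E t u b) (ι (ff (e i) (toℕ u))))) ⟩
    sumF (ℕ.suc t) (λ u → p i * (pow z (e i) * (E t u b * ι (ff (e i) (toℕ u)))))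
      ≈⟨ sym (sumF-*ˡ₂ (ℕ.suc t) (p i) (pow z (e i)) (λ u → E t u b * ι (ff (e i) (toℕ u)))) ⟩
    p i * (pow z (e i) * sumF (ℕ.suc t) (λ u → E t u b * ι (ff (e i) (toℕ u))))
      ≈⟨ *-congˡ (*-congˡ (sym (D-expand-lastColumn t b (e i)))) ⟩
    p i * (pow z (e i) * D t b (e i)) ∎
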